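{- There is no $\mathsf{Clo}$ proof of the sequent $\Phi=\{\nu x.\phi,\nu y.\psi\}$, where $\nu x.\phi \equiv \nu x.\Diamond(\bar p\land(\Box x\lor\Diamond\nu y.\Box(p\land(\Box x\lor\Diamond y))))$ and $\nu y.\psi\equiv \nu y.\Box(p\land(\Box\nu x.\phi\lor\Diamond y))$.
   Context: Modal $\mu$-calculus formulas: $\phi ::= p \mid \bar p \mid x \mid \phi\lor\phi \mid \phi\land\phi \mid \Diamond\phi \mid \Box\phi \mid \mu x.\phi \mid \nu x.\phi$, $p$ a propositional variable, $\bar p$ its negation, $x$ a formal variable; sequents are finite sets of closed, clean formulas (each formal variable bound by a unique fixpoint subformula $\eta x.\phi$); subsumption order $x\le y$ iff $x$ occurs free in $\eta y.\psi$; $\phi[\eta x.\phi]$ is the unfolding (replace $x$ by $\eta x.\phi$ in $\phi$); $\Diamond\Gamma=\{\Diamond\chi:\chi\in\Gamma\}$. $\mathsf{Clo}$: for each formal variable $x$ an infinite set $N_x$ of names, pairwise disjoint, $N=\bigcup N_x$; $\mathfrak y\in N_y$ satisfies $\mathfrak y\le x$ iff $y\le x$, and $a\in N^*$ satisfies $a\le x$ iff all its names do; $\sqsubseteq$ is the reflexive sub-word relation on $N^*$. Annotated formulas $\phi^a$ ($\phi$ closed, $a\in N^*$); annotated sequents are sets of them. Rules (premises / conclusion): Ax: $p^\epsilon,\bar p^\epsilon$; $\lor$: $\Gamma,\phi^a,\psi^a$ / $\Gamma,(\phi\lor\psi)^a$; $\land$: $\Gamma,\phi^a$ and $\Gamma,\psi^a$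 / $\Gamma,(\phi\land\psi)^a$; weakening: $\Gamma$ / $\Gamma,\phi^a$; $\Box$: $\Gamma,\phi^a$ / $\Diamond\Gamma,\Box\phi^a$; $\eta$: $\Gamma,\phi[\eta x.\phi]^a$ / $\Gamma,\eta x.\phi^a$ if $a\le x$; Exp: $\phi_1^{a_1},\dots,\phi_n^{a_n}$ / $\phi_1^{b_1},\dots,\phi_n^{b_n}$ if $a_i\sqsubseteq b_i$ for all $i$; $\mathsf{Clo}_{\mathfrak x}$: $\Gamma,\phi[\nu x.\phi]^{a\mathfrak x}$ / $\Gamma,\nu x.\phi^a$, where $a\le\mathfrak x$ and $\mathfrak x\in N_x$ does not occur in $\Gamma$; leaves above it labelled $\Gamma,\nu x.\phi^{a\mathfrak x}$ may be marked $\mathfrak x$ (discharged assumptions, whose companion is this rule instance). A $\mathsf{Clo}$ derivation is a tree of these rules whose leaves are Ax or discharged assumptions whose companion is an ancestor, each $\mathsf{Clo}$ instance carrying a unique token (in $N_x$ when its principal formula is $\nu x.\phi$). A $\mathsf{Clo}$ proof of $\Gamma$ is a finite $\mathsf{Clo}$ derivation with root $\Gamma$. -}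

module Defs where

open import Data.Nat using (ℕ; _≟_)
open import Data.List using (List; []; _∷_; _++_; map)
open import Data.Product using (Σ; _×_; _,_)
open import Data.Sum using (_⊎_)
open import Relation.Nullary using (¬_; yes; no)
open import Relation.Binary.PropositionalEquality using (_≡_)
open import Data.List.Membership.Propositional using (_∈_; _∉_)
open import Data.List.Relation.Unary.All using (All)
open import Data.List.Relation.Unary.Unique.Propositional using (Unique)
open import Data.List.Relation.Binary.Pointwise using (Pointwise)
open import Data.List.Relation.Binary.Sublist.Propositional using (_⊆_)

data FP : Set where
  mu nu : FP

data Fml : Set where
  pos neg : ℕ → Fml
  var     : ℕ → Fml
  _⋁_ _⋀_ : Fml → Fml → Fml
  ◇_ □_   : Fml → Fml
  fix     : FP → ℕ → Fml → Fml

infixr 8 _⋀_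
infixr 7 _⋁_
infix 9 ◇_ □_

sub : ℕ → Fml → Fml → Fml
sub x χ (pos p) = pos p
sub x χ (neg p) = neg p
sub x χ (var z) with x ≟ z
... | yes _ = χ
... | no  _ = var z
sub x χ (φ ⋁ ψ) = sub x χ φ ⋁ sub x χ ψ
sub x χ (φ ⋀ ψ) = sub x χ φ ⋀ sub x χ ψ
sub x χ (◇ φ) = ◇ sub x χ φ
sub x χ (□ φ) = □ sub x χ φ
sub x χ (fix k z φ) with x ≟ z
... | yes _ = fix k z φ
... | no  _ = fix k z (sub x χ φ)

unfold : FP → ℕ → Fml → Fml
unfold k x φ = sub x (fix k x φ) φ

data FreeIn (x : ℕ) : Fml → Set where
  fv-var : FreeIn x (var x)
  fv-∨l  : ∀ {φ ψ} → FreeIn x φ → FreeIn x (φ ⋁ ψ)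
  fv-∨r  : ∀ {φ ψ} → FreeIn x ψ → FreeIn x (φ ⋁ ψ)
  fv-∧l  : ∀ {φ ψ} → FreeIn x φ → FreeIn x (φ ⋀ ψ)
  fv-∧r  : ∀ {φ ψ} → FreeIn x ψ → FreeIn x (φ ⋀ ψ)
  fv-◇   : ∀ {φ} → FreeIn x φ → FreeIn x (◇ φ)
  fv-□   : ∀ {φ} → FreeIn x φ → FreeIn x (□ φ)
  fv-fix : ∀ {k z φ} → ¬ (x ≡ z) → FreeIn x φ → FreeIn x (fix k z φ)

x y p : ℕ
x = 0
y = 1
p = 0

νyOpen : Fml
νyOpen = fix nu y (□ (pos p ⋀ (□ var x ⋁ ◇ var y)))

φ-body : Fml
φ-body = ◇ (neg p ⋀ (□ var x ⋁ ◇ νyOpen))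

νxφ : Fml
νxφ = fix nu x φ-body

ψ-body : Fml
ψ-body = □ (pos p ⋀ (□ νxφ ⋁ ◇ var y))

νyψ : Fml
νyψ = fix nu y ψ-body

-- The unique fixpoint subformula binding each formal variable of Φ
-- (other variables do not occur; they get a dummy closed formula).
binder : ℕ → Fml
binder 0 = νxφ
binder 1 = νyOpen
binder _ = pos 0

_≼_ : ℕ → ℕ → Set
v ≼ w = v ≡ w ⊎ FreeIn v (binder w)

-- Names and annotations.  N_v = { (v , i) | i : ℕ }.

record Name : Set where
  constructor nm
  field
    nvar : ℕ
    nidx : ℕ
open Name public

Annot : Set
Annot = List Name

_≤A_ : Annot → ℕ → Set
a ≤A v = All (λ n → nvar n ≼ v) a

record AFml : Set where
  constructor _^_
  field
    fml : Fml
    ann : Annot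
open AFml public

infix 6 _^_

Seq : Set
Seq = List AFml

_≐_ : Seq → Seq → Set
Γ ≐ Δ = ∀ z → (z ∈ Γ → z ∈ Δ) × (z ∈ Δ → z ∈ Γ)

◇S : Seq → Seq
◇S = map (λ { (φ ^ a) → (◇ φ) ^ a })

FreshIn : Name → Seq → Set
FreshIn n Γ = All (λ z → n ∉ ann z) Γ

ExpRel : AFml → AFml → Set
ExpRel (φ ^ a) (ψ ^ b) = (φ ≡ ψ) × (a ⊆ b)

-- Clo derivations.  An open assumption records a companion Clo_𝔵
-- instance with conclusion Γ, νx.φ^a.

record Asm : Set where
  constructor asm
  field
    tok  : Name
    ctx  : Seq
    avar : ℕ
    body : Fml
    aann : Annot

-- Der C Δ : Clo derivations of Δ whose discharged leaves point to
-- companions among the ancestors C.  Conclusions are taken up to ≐.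
data Der (C : List Asm) : Seq → Set where
  ax   : ∀ {Δ} q → Δ ≐ (pos q ^ [] ∷ neg q ^ [] ∷ []) → Der C Δ
  or   : ∀ {Δ} Γ φ ψ a → Der C (φ ^ a ∷ ψ ^ a ∷ Γ) →
         Δ ≐ ((φ ⋁ ψ) ^ a ∷ Γ) → Der C Δ
  and  : ∀ {Δ} Γ φ ψ a → Der C (φ ^ a ∷ Γ) → Der C (ψ ^ a ∷ Γ) →
         Δ ≐ ((φ ⋀ ψ) ^ a ∷ Γ) → Der C Δ
  weak : ∀ {Δ} Γ φ a → Der C Γ → Δ ≐ (φ ^ a ∷ Γ) → Der C Δ
  box  : ∀ {Δ} Γ φ a → Der C (φ ^ a ∷ Γ) →
         Δ ≐ ((□ φ) ^ a ∷ ◇S Γ) → Der C Δ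
  eta  : ∀ {Δ} Γ k v φ a → a ≤A v → Der C (unfold k v φ ^ a ∷ Γ) →
         Δ ≐ (fix k v φ ^ a ∷ Γ) → Der C Δ
  exp  : ∀ {Δ} Γ Γ' → Pointwise ExpRel Γ Γ' → Der C Γ → Δ ≐ Γ' → Der C Δ
  clo  : ∀ {Δ} Γ v φ a (n : Name) → nvar n ≡ v → a ≤A v → FreshIn n Γ →
         Der (asm n Γ v φ a ∷ C) (unfold nu v φ ^ (a ++ n ∷ []) ∷ Γ) →
         Δ ≐ (fix nu v φ ^ a ∷ Γ) → Der C Δ
  disch : ∀ {Δ n Γ v φ a} → asm n Γ v φ a ∈ C →
         Δ ≐ (fix nu v φ ^ (a ++ n ∷ []) ∷ Γ) → Der C Δ

tokens : ∀ {C Δ} → Der C Δ → List Name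
tokens (ax _ _) = []
tokens (or _ _ _ _ d _) = tokens d
tokens (and _ _ _ _ d e _) = tokens d ++ tokens e
tokens (weak _ _ _ d _) = tokens d
tokens (box _ _ _ d _) = tokens d
tokens (eta _ _ _ _ _ _ d _) = tokens d
tokens (exp _ _ _ d _) = tokens d
tokens (clo _ _ _ _ n _ _ _ d _) = n ∷ tokens d
tokens (disch _ _) = []

CloProof : Seq → Set
CloProof Δ = Σ (Der [] Δ) (λ d → Unique (tokens d))

Φ : Seq
Φ = νxφ ^ [] ∷ νyψ ^ [] ∷ []

-- Follow a single branch of a purported proof upwards.  Between □-steps its
-- sequents consist of νxφ, νyψ and their unfoldings ◇φ∧ and □ψ∧.  A □-step
-- leaves ψ∧ next to copies of φ∧; the branch resolves one side to its atom
-- (p from ψ∧, p̄ from φ∧) and the other to □νxφ ∨ ◇νyψ, so it never meets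
-- an axiom, and the next □-step brings it back to νxφ and νyψ.
--
-- Every leaf would therefore be a discharged assumption.  Call a companion
-- dead once a name of its leaf sequent has vanished from the branch: names
-- only disappear going up (Clo tokens are fresh), so it can never be
-- discharged.  A companion introduced since the last □-step is live: its
-- token occurs neither on νxφ nor on νyψ, only on unfoldings of its own
-- fixpoint, so it cannot be discharged before the next □-step.  There, take
-- the oldest live companion w whose token is still present and resolve to
-- its atom the side carrying that token.  Then every live companion dies:
-- either its own token is already gone, or its leaf sequent contains the
-- token of w, which vanishes now.

module Submission where

open import Defs
open import Data.Nat using (_≟_)
open import Data.List using (List; []; _∷_; _++_; map)
open import Data.List.Membership.Propositional using (_∈_; _∉_; find)
open import Data.List.Membership.Propositional.Properties using (∈-++⁺ˡ; ∈-++⁺ʳ; ∈-++⁻; ∈-map⁺)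
open import Data.List.Relation.Unary.Any using (Any; here; there; any?)
open import Data.List.Relation.Unary.All as All using (All; []; _∷_)
open import Data.List.Relation.Unary.All.Properties using (++⁺; ++⁻ˡ)
open import Data.List.Relation.Unary.AllPairs using (AllPairs; []; _∷_)
open import Data.List.Relation.Unary.Unique.Propositional using (Unique)
open import Data.List.Relation.Unary.Unique.Propositional.Properties using (Unique[x∷xs]⇒x∉xs)
open import Data.List.Relation.Binary.Disjoint.Propositional using (Disjoint)
open import Data.List.Relation.Binary.Pointwise using (Pointwise; []; _∷_)
open import Data.List.Relation.Binary.Sublist.Propositional.Properties using (Any-resp-⊆)
import Data.List.Relation.Binary.Subset.Propositional.Properties as Subset
open import Data.Product using (∃-syntax; _×_; _,_; proj₁; proj₂)
open import Data.Sum using (_⊎_; inj₁; inj₂)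
open import Data.Empty using (⊥; ⊥-elim)
open import Data.Unit using (⊤; tt)
open import Function using (_∘_; const)
open import Relation.Nullary using (¬_; Dec; yes; no)
open import Relation.Nullary.Decidable using (map′; _×-dec_)
open import Relation.Binary.Definitions using (DecidableEquality)
open import Relation.Binary.PropositionalEquality using (_≡_; refl)

open Asm

_≟ₙ_ : DecidableEquality Name
nm v i ≟ₙ nm w j =
  map′ (λ { (refl , refl) → refl }) (λ { refl → refl , refl }) (v ≟ w ×-dec i ≟ j)

open import Data.List.Membership.DecPropositional _≟ₙ_ using (_∈?_)

Unique-++⁻ˡ : ∀ {A : Set} (xs : List A) {ys} → Unique (xs ++ ys) → Unique xs
Unique-++⁻ˡ [] _ = []
Unique-++⁻ˡ (_ ∷ xs) (x∉ ∷ u) = ++⁻ˡ xs x∉ ∷ Unique-++⁻ˡ xs u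

Unique-++⁻ʳ : ∀ {A : Set} (xs : List A) {ys} → Unique (xs ++ ys) → Unique ys
Unique-++⁻ʳ [] u = u
Unique-++⁻ʳ (_ ∷ xs) (_ ∷ u) = Unique-++⁻ʳ xs u

∈-≐ : ∀ {Δ Λ z} → Δ ≐ Λ → z ∈ Λ → z ∈ Δ
∈-≐ eq = proj₂ (eq _)

principal : ∀ {P : AFml → Set} {Δ z Γ} → (∀ z → z ∈ Δ → P z) → Δ ≐ (z ∷ Γ) → P z
principal forms eq = forms _ (∈-≐ eq (here refl))

exp-source : ∀ {Γ Γ' z} → Pointwise ExpRel Γ Γ' → z ∈ Γ → ∃[ z' ] z' ∈ Γ' × ExpRel z z'
exp-source (rel ∷ _) (here refl) = _ , here refl , rel
exp-source (_ ∷ rels) (there i) with exp-source rels i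
... | z' , j , rel = z' , there j , rel

Occ : (Fml → Set) → Seq → Name → Set
Occ L Δ m = Any (λ z → L (fml z) × m ∈ ann z) Δ

Occurs : Seq → Name → Set
Occurs = Occ (λ _ → ⊤)

occurs? : ∀ Δ m → Dec (Occurs Δ m)
occurs? Δ m = any? (λ z → yes tt ×-dec m ∈? ann z) Δ

occ-≐ : ∀ {L Δ Λ m} → Δ ≐ Λ → Occ L Λ m → Occ L Δ m
occ-≐ eq = Subset.Any-resp-⊆ (∈-≐ eq)

occ-replace : ∀ {L Δ Γ ζ a m} χs → Δ ≐ (ζ ^ a ∷ Γ) → All (λ χ → L χ → L ζ) χs →
              Occ L (map (_^ a) χs ++ Γ) m → Occ L Δ m
occ-replace [] eq [] o = occ-≐ eq (there o)
occ-replace (_ ∷ _) eq (f ∷ _) (here (l , t)) = occ-≐ eq (here (f l , t))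
occ-replace (_ ∷ χs) eq (_ ∷ fs) (there o) = occ-replace χs eq fs o

occ-exp : ∀ {L Γ Γ' m} → Pointwise ExpRel Γ Γ' → Occ L Γ m → Occ L Γ' m
occ-exp ((refl , s) ∷ _) (here (l , t)) = here (l , Any-resp-⊆ s t)
occ-exp (_ ∷ rels) (there o) = there (occ-exp rels o)

occ-◇ : ∀ {L L' Γ m} → (∀ {z} → z ∈ Γ → L' (fml z) → L (◇ fml z)) →
        Occ L' Γ m → Occ L (◇S Γ) m
occ-◇ g (here (l , t)) = here (g (here refl) l , t)
occ-◇ g (there o) = there (occ-◇ (g ∘ there) o)

occ-box : ∀ {L L' Δ φ a Γ m} → Δ ≐ (□ φ ^ a ∷ ◇S Γ) →
          (L' φ → L (□ φ)) → (∀ {z} → z ∈ Γ → L' (fml z) → L (◇ fml z)) →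
          Occ L' (φ ^ a ∷ Γ) m → Occ L Δ m
occ-box eq f g (here (l , t)) = occ-≐ eq (here (f l , t))
occ-box eq f g (there o) = occ-≐ eq (there (occ-◇ g o))

occurs-head : ∀ {χ χ' b Γ m} → Occurs (χ ^ b ∷ Γ) m → Occurs (χ' ^ b ∷ Γ) m
occurs-head (here o) = here o
occurs-head (there o) = there o

forms-replace : ∀ {P : AFml → Set} {Δ Γ ζ a} → (∀ z → z ∈ Δ → P z) → Δ ≐ (ζ ^ a ∷ Γ) →
                ∀ {χs} → All (λ χ → P (χ ^ a)) χs → ∀ z → z ∈ map (_^ a) χs ++ Γ → P z
forms-replace forms eq [] z i = forms z (∈-≐ eq (there i))
forms-replace forms eq (p ∷ _) _ (here refl) = p
forms-replace forms eq (_ ∷ ps) z (there i) = forms-replace forms eq ps z i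

leaf : Asm → Seq
leaf r = fix nu (avar r) (body r) ^ (aann r ++ tok r ∷ []) ∷ ctx r

tok-in-leaf : ∀ r → Occurs (leaf r) (tok r)
tok-in-leaf r = here (tt , ∈-++⁺ʳ (aann r) (here refl))

Dead : List Asm → (Name → Set) → Asm → Set
Dead C O r = ∃[ m ] m ∈ map tok C × Occurs (leaf r) m × ¬ O m

dead-mono : ∀ {C O O' r} → (∀ {m} → O' m → O m) → Dead C O r → Dead C O' r
dead-mono cov (m , m∈ , o , ¬o) = m , m∈ , o , ¬o ∘ cov

bury : ∀ {C Δ O} R → (∀ {m} → O m → Occurs Δ m) → All (λ r → tok r ∈ map tok C) R →
       All (λ r → Occurs Δ (tok r) → Dead C O r) R → All (Dead C O) R
bury [] cov [] [] = []
bury {C} {Δ} {O} (r ∷ R) cov (t∈ ∷ t∈s) (dead ∷ deads) =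
  buried (occurs? Δ (tok r)) ∷ bury R cov t∈s deads
  where
    buried : Dec (Occurs Δ (tok r)) → Dead C O r
    buried (yes o) = dead o
    buried (no ¬o) = tok r , t∈ , tok-in-leaf r , ¬o ∘ cov

-- Sequents of fixpoints and their unfoldings

IsX : Asm → Set
IsX r = avar r ≡ x

data FixForm (R : List Asm) : AFml → Set where
  νxφ-form : ∀ {h} → All (λ r → tok r ∉ h) R → FixForm R (νxφ ^ h)
  νyψ-form : ∀ {h} → All (λ r → tok r ∉ h) R → FixForm R (νyψ ^ h)
  φ-unf-form : ∀ {h} → All (λ r → ¬ IsX r → tok r ∉ h) R → FixForm R (unfold nu x φ-body ^ h)
  ψ-unf-form : ∀ {h} → All (λ r → IsX r → tok r ∉ h) R → FixForm R (unfold nu y ψ-body ^ h)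

fix-form-⊆ : ∀ {R z z'} → ExpRel z z' → FixForm R z' → FixForm R z
fix-form-⊆ (refl , s) (νxφ-form av) = νxφ-form (All.map (λ t∉ → t∉ ∘ Any-resp-⊆ s) av)
fix-form-⊆ (refl , s) (νyψ-form av) = νyψ-form (All.map (λ t∉ → t∉ ∘ Any-resp-⊆ s) av)
fix-form-⊆ (refl , s) (φ-unf-form av) = φ-unf-form (All.map (λ t∉ ¬x → t∉ ¬x ∘ Any-resp-⊆ s) av)
fix-form-⊆ (refl , s) (ψ-unf-form av) = ψ-unf-form (All.map (λ t∉ isX → t∉ isX ∘ Any-resp-⊆ s) av)

fix-form-∷ : ∀ {R z r} → tok r ∉ ann z → FixForm R z → FixForm (r ∷ R) z
fix-form-∷ t∉ (νxφ-form av) = νxφ-form (t∉ ∷ av)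
fix-form-∷ t∉ (νyψ-form av) = νyψ-form (t∉ ∷ av)
fix-form-∷ t∉ (φ-unf-form av) = φ-unf-form ((λ _ → t∉) ∷ av)
fix-form-∷ t∉ (ψ-unf-form av) = ψ-unf-form ((λ _ → t∉) ∷ av)

-- Companions are listed newest first.
Nested : Seq → List Asm → Set
Nested Δ = AllPairs (λ r r' → Occurs Δ (tok r') → Occurs (leaf r) (tok r'))

nested-mono : ∀ {P Δ T} R → All (λ r → tok r ∈ T) R →
              (∀ {m} → m ∈ T → Occurs P m → Occurs Δ m) → Nested Δ R → Nested P R
nested-mono [] [] cov [] = []
nested-mono (_ ∷ R) (_ ∷ t∈s) cov (older ∷ nest) =
  All.zipWith (λ (t∈ , f) → f ∘ cov t∈) (t∈s , older) ∷ nested-mono R t∈s cov nest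

Oldest : Seq → List Asm → Set
Oldest Δ R = All (λ r → ¬ Occurs Δ (tok r)) R ⊎
             ∃[ w ] w ∈ R × Occurs Δ (tok w) × All (λ r → Occurs Δ (tok r) → Occurs (leaf r) (tok w)) R

oldest : ∀ {Δ} R → Nested Δ R → Oldest Δ R
oldest [] [] = inj₁ []
oldest {Δ} (r ∷ R) (older ∷ nest) with oldest R nest
... | inj₂ (w , w∈ , o , anchored) =
  inj₂ (w , there w∈ , o , (λ _ → All.lookup older w∈ o) ∷ anchored)
... | inj₁ none with occurs? Δ (tok r)
...   | yes o =
  inj₂ (r , here refl , o , (λ _ → tok-in-leaf r) ∷ All.map (λ ¬o o → ⊥-elim (¬o o)) none)
...   | no ¬o = inj₁ (¬o ∷ none)

record FixInv (C : List Asm) (Δ : Seq) : Set where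
  constructor fixInv
  field
    live dead : List Asm
    split : C ≡ live ++ dead
    nested : Nested Δ live
    buried : All (Dead C (Occurs Δ)) dead
    forms : ∀ z → z ∈ Δ → FixForm live z

live-tokens : ∀ {C Δ} (inv : FixInv C Δ) → All (λ r → tok r ∈ map tok C) (FixInv.live inv)
live-tokens (fixInv _ _ refl _ _ _) = All.tabulate (∈-map⁺ tok ∘ ∈-++⁺ˡ)

∉-++-fresh : ∀ {T a n R} → All (λ r → tok r ∈ T) R → n ∉ T →
             All (λ r → tok r ∉ a) R → All (λ r → tok r ∉ a ++ n ∷ []) R
∉-++-fresh {T} {a} {n} t∈s n∉ av = All.zipWith (λ {r} → avoid {r}) (t∈s , av)
  where
    avoid : ∀ {r} → tok r ∈ T × tok r ∉ a → tok r ∉ a ++ n ∷ []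
    avoid (t∈ , t∉) t with ∈-++⁻ a t
    ... | inj₁ t' = t∉ t'
    ... | inj₂ (here refl) = n∉ t∈

fix-transport : ∀ {C Δ P} (inv : FixInv C Δ) → (∀ {m} → Occurs P m → Occurs Δ m) →
                (∀ z → z ∈ P → FixForm (FixInv.live inv) z) → FixInv C P
fix-transport inv@(fixInv L D split nest bur _) cov forms =
  fixInv L D split (nested-mono L (live-tokens inv) (λ _ → cov) nest)
         (All.map (dead-mono cov) bur) forms

fix-local : ∀ {C Δ Γ ζ a} (inv : FixInv C Δ) → Δ ≐ (ζ ^ a ∷ Γ) → (χs : List Fml) →
            All (λ χ → FixForm (FixInv.live inv) (χ ^ a)) χs → FixInv C (map (_^ a) χs ++ Γ)
fix-local inv eq χs new =
  fix-transport inv (occ-replace χs eq (All.universal (λ _ _ → tt) χs))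
                (forms-replace (FixInv.forms inv) eq new)

fix-exp : ∀ {C Δ Γ Γ'} (inv : FixInv C Δ) → Pointwise ExpRel Γ Γ' → Δ ≐ Γ' → FixInv C Γ
fix-exp {Γ = Γ} inv rels eq = fix-transport inv (occ-≐ eq ∘ occ-exp rels) forms
  where
    forms : ∀ z → z ∈ Γ → FixForm (FixInv.live inv) z
    forms z i with exp-source rels i
    ... | z' , j , rel = fix-form-⊆ rel (FixInv.forms inv z' (∈-≐ eq j))

fix-clo : ∀ {C Δ Γ v φ a n} (inv : FixInv C Δ) → Δ ≐ (fix nu v φ ^ a ∷ Γ) → FreshIn n Γ →
          n ∉ map tok C → FixForm (asm n Γ v φ a ∷ FixInv.live inv) (unfold nu v φ ^ (a ++ n ∷ [])) →
          FixInv (asm n Γ v φ a ∷ C) (unfold nu v φ ^ (a ++ n ∷ []) ∷ Γ)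
fix-clo {C} {Δ} {Γ} {v} {φ} {a} {n} inv@(fixInv L D refl nest bur forms) eq fresh n∉C new =
  fixInv (asm n Γ v φ a ∷ L) D refl
         (All.universal (λ _ → occurs-head) L ∷ nested-mono L (live-tokens inv) old-occurs nest)
         (All.map (λ (m , m∈ , o , ¬o) → m , there m∈ , o , ¬o ∘ old-occurs m∈) bur)
         forms'
  where
    P : Seq
    P = unfold nu v φ ^ (a ++ n ∷ []) ∷ Γ

    old-occurs : ∀ {m} → m ∈ map tok C → Occurs P m → Occurs Δ m
    old-occurs m∈ (here (_ , t)) with ∈-++⁻ a t
    ... | inj₁ t' = occ-≐ eq (here (tt , t'))
    ... | inj₂ (here refl) = ⊥-elim (n∉C m∈)
    old-occurs m∈ (there o) = occ-≐ eq (there o)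

    forms' : ∀ z → z ∈ P → FixForm (asm n Γ v φ a ∷ L) z
    forms' _ (here refl) = new
    forms' z (there i) = fix-form-∷ (All.lookup fresh i) (forms z (∈-≐ eq (there i)))

-- Sequents of subformulas of φ∧ and ψ∧

choice φ∧ ψ∧ : Fml
choice = □ νxφ ⋁ ◇ νyψ
φ∧ = neg p ⋀ choice
ψ∧ = pos p ⋀ choice

-- On the φ-side the branch settles ψ∧ by its premise p and keeps the φ∧
-- formulas live, on the ψ-side the other way round.  Only live formulas can
-- reach the next □-step.
data Side : Set where
  φ-side ψ-side : Side

data Live : Side → Fml → Set where
  choice-live : ∀ {s} → Live s choice
  □νx-live : ∀ {s} → Live s (□ νxφ)
  ◇νy-live : ∀ {s} → Live s (◇ νyψ)
  φ∧-live : Live φ-side φ∧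
  ψ∧-live : Live ψ-side ψ∧

data Settled : Side → Fml → Set where
  ψ∧-settled : Settled φ-side ψ∧
  p-settled : Settled φ-side (pos p)
  φ∧-settled : Settled ψ-side φ∧
  ¬p-settled : Settled ψ-side (neg p)

ConjForm : Side → Fml → Set
ConjForm s χ = Live s χ ⊎ Settled s χ

record ConjInv (s : Side) (C : List Asm) (Δ : Seq) : Set where
  constructor conjInv
  field
    buried : All (Dead C (Occ (Live s) Δ)) C
    forms : ∀ z → z ∈ Δ → ConjForm s (fml z)

conj-transport : ∀ {s C Δ P} → ConjInv s C Δ → (∀ {m} → Occ (Live s) P m → Occ (Live s) Δ m) →
                 (∀ z → z ∈ P → ConjForm s (fml z)) → ConjInv s C P
conj-transport (conjInv bur _) cov = conjInv (All.map (dead-mono cov) bur)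

conj-local : ∀ {s C Δ Γ ζ a} → ConjInv s C Δ → Δ ≐ (ζ ^ a ∷ Γ) → (χs : List Fml) →
             All (λ χ → ConjForm s χ × (Live s χ → Live s ζ)) χs → ConjInv s C (map (_^ a) χs ++ Γ)
conj-local inv eq χs new =
  conj-transport inv (occ-replace χs eq (All.map proj₂ new))
                 (forms-replace (ConjInv.forms inv) eq (All.map proj₁ new))

conj-exp : ∀ {s C Δ Γ Γ'} → ConjInv s C Δ → Pointwise ExpRel Γ Γ' → Δ ≐ Γ' → ConjInv s C Γ
conj-exp {s} {Γ = Γ} inv rels eq = conj-transport inv (occ-≐ eq ∘ occ-exp rels) forms
  where
    forms : ∀ z → z ∈ Γ → ConjForm s (fml z)
    forms z i with exp-source rels i
    ... | z' , j , (refl , _) = ConjInv.forms inv z' (∈-≐ eq j)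

conj-box : ∀ {s C Δ φ a Γ} → ConjInv s C Δ → Δ ≐ (□ φ ^ a ∷ ◇S Γ) → FixInv C (φ ^ a ∷ Γ)
conj-box {s} {C} {a = a} {Γ} (conjInv bur forms) eq with principal forms eq
... | inj₁ □νx-live =
  fixInv [] C refl [] (All.map (dead-mono (occ-box eq (λ _ → □νx-live) (λ i _ → context i))) bur)
         forms'
  where
    context : ∀ {z} → z ∈ Γ → Live s (◇ fml z)
    context i with forms _ (∈-≐ eq (there (∈-map⁺ _ i)))
    ... | inj₁ l = l

    forms' : ∀ z → z ∈ νxφ ^ a ∷ Γ → FixForm [] z
    forms' _ (here refl) = νxφ-form []
    forms' (χ ^ c) (there i) with context i
    ... | ◇νy-live = νyψ-form []

BoxContext : List Asm → Seq → Set
BoxContext L Γ = ∀ {χ c} → χ ^ c ∈ Γ → FixForm L (◇ χ ^ c)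

φ-side-forms : ∀ {L Γ a} → BoxContext L Γ → ∀ z → z ∈ ψ∧ ^ a ∷ Γ → ConjForm φ-side (fml z)
φ-side-forms context _ (here refl) = inj₂ ψ∧-settled
φ-side-forms context (χ ^ c) (there i) with context i
... | φ-unf-form _ = inj₁ φ∧-live

ψ-side-forms : ∀ {L Γ a} → BoxContext L Γ → ∀ z → z ∈ ψ∧ ^ a ∷ Γ → ConjForm ψ-side (fml z)
ψ-side-forms context _ (here refl) = inj₁ ψ∧-live
ψ-side-forms context (χ ^ c) (there i) with context i
... | φ-unf-form _ = inj₂ φ∧-settled

φ-side-hides : ∀ {L Γ a w} → BoxContext L Γ → w ∈ L → ¬ IsX w →
               ¬ Occ (Live φ-side) (ψ∧ ^ a ∷ Γ) (tok w)
φ-side-hides context w∈ ¬w-x (there o) with find o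
... | (χ ^ c) , i , _ , t with context i
...   | φ-unf-form av = All.lookup av w∈ ¬w-x t

ψ-side-hides : ∀ {L Γ a w} → BoxContext L Γ → All (λ r → IsX r → tok r ∉ a) L → w ∈ L → IsX w →
               ¬ Occ (Live ψ-side) (ψ∧ ^ a ∷ Γ) (tok w)
ψ-side-hides context a-avoids w∈ w-x (here (_ , t)) = All.lookup a-avoids w∈ w-x t
ψ-side-hides context a-avoids w∈ w-x (there o) with find o
... | (χ ^ c) , i , l , _ with context i | l
...   | φ-unf-form _ | ()

fix-box : ∀ {C Δ a Γ} (inv : FixInv C Δ) → Δ ≐ (□ ψ∧ ^ a ∷ ◇S Γ) →
          All (λ r → IsX r → tok r ∉ a) (FixInv.live inv) → ∃[ s ] ConjInv s C (ψ∧ ^ a ∷ Γ)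
fix-box {C} {Δ} {a} {Γ} inv@(fixInv L D refl nest bur forms) eq a-avoids = choose (oldest L nest)
  where
    context : BoxContext L Γ
    context i = forms _ (∈-≐ eq (there (∈-map⁺ _ i)))

    cov : ∀ {s m} → Occ (Live s) (ψ∧ ^ a ∷ Γ) m → Occurs Δ m
    cov = occ-box eq (λ _ → tt) (λ _ _ → tt)

    bury-all : ∀ {s} → All (λ r → Occurs Δ (tok r) → Dead C (Occ (Live s) (ψ∧ ^ a ∷ Γ)) r) L →
               All (Dead C (Occ (Live s) (ψ∧ ^ a ∷ Γ))) C
    bury-all dead-if-present =
      ++⁺ (bury L cov (live-tokens inv) dead-if-present) (All.map (dead-mono cov) bur)

    dead-by : ∀ {s w} → w ∈ L → ¬ Occ (Live s) (ψ∧ ^ a ∷ Γ) (tok w) →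
              All (λ r → Occurs Δ (tok r) → Occurs (leaf r) (tok w)) L →
              All (λ r → Occurs Δ (tok r) → Dead C (Occ (Live s) (ψ∧ ^ a ∷ Γ)) r) L
    dead-by {w = w} w∈ hidden =
      All.map (λ anchored o → tok w , All.lookup (live-tokens inv) w∈ , anchored o , hidden)

    choose : Oldest Δ L → ∃[ s ] ConjInv s C (ψ∧ ^ a ∷ Γ)
    choose (inj₁ absent) =
      φ-side , conjInv (bury-all (All.map (λ ¬o o → ⊥-elim (¬o o)) absent)) (φ-side-forms context)
    choose (inj₂ (w , w∈ , _ , anchored)) with avar w ≟ x
    ... | yes w-x =
      ψ-side , conjInv (bury-all (dead-by w∈ (ψ-side-hides context a-avoids w∈ w-x) anchored))
                       (ψ-side-forms context)
    ... | no ¬w-x =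
      φ-side , conjInv (bury-all (dead-by w∈ (φ-side-hides context w∈ ¬w-x) anchored))
                       (φ-side-forms context)

data State (C : List Asm) (Δ : Seq) : Set where
  in-fix : FixInv C Δ → State C Δ
  in-conj : ∀ s → ConjInv s C Δ → State C Δ

ax-unreachable : ∀ {C Δ q} → State C Δ → ¬ Δ ≐ (pos q ^ [] ∷ neg q ^ [] ∷ [])
ax-unreachable (in-fix inv) eq with principal (FixInv.forms inv) eq
... | ()
ax-unreachable (in-conj φ-side inv) eq with ConjInv.forms inv _ (∈-≐ eq (there (here refl)))
... | inj₁ ()
... | inj₂ ()
ax-unreachable (in-conj ψ-side inv) eq with principal (ConjInv.forms inv) eq
... | inj₁ ()
... | inj₂ ()

disch-unreachable : ∀ {C Δ n Γ v φ a} → State C Δ → asm n Γ v φ a ∈ C →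
                    ¬ Δ ≐ (fix nu v φ ^ (a ++ n ∷ []) ∷ Γ)
disch-unreachable (in-fix (fixInv L _ refl _ bur _)) i eq with ∈-++⁻ L i
... | inj₂ i-dead with All.lookup bur i-dead
...   | _ , _ , o , ¬o = ¬o (occ-≐ eq o)
disch-unreachable {a = a} (in-fix (fixInv L _ refl _ bur forms)) i eq | inj₁ i-live
  with principal forms eq
... | νxφ-form av = All.lookup av i-live (∈-++⁺ʳ a (here refl))
... | νyψ-form av = All.lookup av i-live (∈-++⁺ʳ a (here refl))
disch-unreachable (in-conj s inv) _ eq with principal (ConjInv.forms inv) eq
... | inj₁ ()
... | inj₂ ()

step-or : ∀ {C Δ Γ φ ψ a} → State C Δ → Δ ≐ ((φ ⋁ ψ) ^ a ∷ Γ) → State C (φ ^ a ∷ ψ ^ a ∷ Γ)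
step-or (in-fix inv) eq with principal (FixInv.forms inv) eq
... | ()
step-or (in-conj s inv) eq with principal (ConjInv.forms inv) eq
... | inj₁ choice-live =
  in-conj s (conj-local inv eq (_ ∷ _ ∷ [])
    ((inj₁ □νx-live , λ _ → choice-live) ∷ (inj₁ ◇νy-live , λ _ → choice-live) ∷ []))

step-and : ∀ {C Δ Γ φ ψ a} → State C Δ → Δ ≐ ((φ ⋀ ψ) ^ a ∷ Γ) →
           State C (φ ^ a ∷ Γ) ⊎ State C (ψ ^ a ∷ Γ)
step-and (in-fix inv) eq with principal (FixInv.forms inv) eq
... | ()
step-and (in-conj φ-side inv) eq with principal (ConjInv.forms inv) eq
... | inj₁ φ∧-live =
  inj₂ (in-conj φ-side (conj-local inv eq (_ ∷ []) ((inj₁ choice-live , λ _ → φ∧-live) ∷ [])))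
... | inj₂ ψ∧-settled =
  inj₁ (in-conj φ-side (conj-local inv eq (_ ∷ []) ((inj₂ p-settled , λ ()) ∷ [])))
step-and (in-conj ψ-side inv) eq with principal (ConjInv.forms inv) eq
... | inj₁ ψ∧-live =
  inj₂ (in-conj ψ-side (conj-local inv eq (_ ∷ []) ((inj₁ choice-live , λ _ → ψ∧-live) ∷ [])))
... | inj₂ φ∧-settled =
  inj₁ (in-conj ψ-side (conj-local inv eq (_ ∷ []) ((inj₂ ¬p-settled , λ ()) ∷ [])))

step-weak : ∀ {C Δ Γ φ a} → State C Δ → Δ ≐ (φ ^ a ∷ Γ) → State C Γ
step-weak (in-fix inv) eq = in-fix (fix-local inv eq [] [])
step-weak (in-conj s inv) eq = in-conj s (conj-local inv eq [] [])

step-exp : ∀ {C Δ Γ Γ'} → State C Δ → Pointwise ExpRel Γ Γ' → Δ ≐ Γ' → State C Γ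
step-exp (in-fix inv) rels eq = in-fix (fix-exp inv rels eq)
step-exp (in-conj s inv) rels eq = in-conj s (conj-exp inv rels eq)

step-box : ∀ {C Δ Γ φ a} → State C Δ → Δ ≐ (□ φ ^ a ∷ ◇S Γ) → State C (φ ^ a ∷ Γ)
step-box (in-fix inv) eq with principal (FixInv.forms inv) eq
... | ψ-unf-form av with fix-box inv eq av
...   | s , inv' = in-conj s inv'
step-box (in-conj s inv) eq = in-fix (conj-box inv eq)

step-eta : ∀ {C Δ Γ k v φ a} → State C Δ → Δ ≐ (fix k v φ ^ a ∷ Γ) → State C (unfold k v φ ^ a ∷ Γ)
step-eta (in-fix inv) eq with principal (FixInv.forms inv) eq
... | νxφ-form av = in-fix (fix-local inv eq (_ ∷ []) (φ-unf-form (All.map const av) ∷ []))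
... | νyψ-form av = in-fix (fix-local inv eq (_ ∷ []) (ψ-unf-form (All.map const av) ∷ []))
step-eta (in-conj s inv) eq with principal (ConjInv.forms inv) eq
... | inj₁ ()
... | inj₂ ()

step-clo : ∀ {C Δ Γ v φ a n} → State C Δ → Δ ≐ (fix nu v φ ^ a ∷ Γ) → FreshIn n Γ →
           n ∉ map tok C → State (asm n Γ v φ a ∷ C) (unfold nu v φ ^ (a ++ n ∷ []) ∷ Γ)
step-clo (in-fix inv) eq fresh n∉C with principal (FixInv.forms inv) eq
... | νxφ-form av = in-fix (fix-clo inv eq fresh n∉C
  (φ-unf-form ((λ ¬x → ⊥-elim (¬x refl)) ∷ All.map const (∉-++-fresh (live-tokens inv) n∉C av))))
... | νyψ-form av = in-fix (fix-clo inv eq fresh n∉C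
  (ψ-unf-form ((λ ()) ∷ All.map const (∉-++-fresh (live-tokens inv) n∉C av))))
step-clo (in-conj s inv) eq _ _ with principal (ConjInv.forms inv) eq
... | inj₁ ()
... | inj₂ ()

refute : ∀ {C Δ} (d : Der C Δ) → Unique (tokens d) → Disjoint (map tok C) (tokens d) →
         State C Δ → ⊥
refute (ax _ eq) _ _ st = ax-unreachable st eq
refute (or _ _ _ _ d eq) u dis st = refute d u dis (step-or st eq)
refute (and _ _ _ _ d e eq) u dis st with step-and st eq
... | inj₁ st' = refute d (Unique-++⁻ˡ (tokens d) u) (λ (c , t) → dis (c , ∈-++⁺ˡ t)) st'
... | inj₂ st' = refute e (Unique-++⁻ʳ (tokens d) u) (λ (c , t) → dis (c , ∈-++⁺ʳ (tokens d) t)) st'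
refute (weak _ _ _ d eq) u dis st = refute d u dis (step-weak st eq)
refute (box _ _ _ d eq) u dis st = refute d u dis (step-box st eq)
refute (eta _ _ _ _ _ _ d eq) u dis st = refute d u dis (step-eta st eq)
refute (exp _ _ rels d eq) u dis st = refute d u dis (step-exp st rels eq)
refute {C} (clo _ _ _ _ n _ _ fresh d eq) u@(_ ∷ u') dis st =
  refute d u' dis' (step-clo st eq fresh (λ c → dis (c , here refl)))
  where
    dis' : Disjoint (n ∷ map tok C) (tokens d)
    dis' (here refl , t) = Unique[x∷xs]⇒x∉xs u t
    dis' (there c , t) = dis (c , there t)
refute (disch i eq) _ _ st = disch-unreachable st i eq

Φ-state : State [] Φ
Φ-state = in-fix (fixInv [] [] refl [] [] forms)
  where
    forms : ∀ z → z ∈ Φ → FixForm [] z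
    forms _ (here refl) = νxφ-form []
    forms _ (there (here refl)) = νyψ-form []

mainTheorem7 : ¬ CloProof Φ
mainTheorem7 (d , u) = refute d u (λ { (() , _) }) Φ-state
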